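{- Let $n\geq1$, let $\mathbf{A}$ be an $n$-ladder, and let $\mathbf{B}$ be a binary relation with $1<\delta(\mathbf{B})<\infty$ and $\delta(\mathbf{B}^\perp)>1$. If $\delta(\mathbf{B})\leq n$, then there is a Tukey morphism $\mathbf{A}\to\mathbf{B}$.
   Context: A binary relation is a triple $\mathbf{A}=(A_-,A_+,A)$ where $A_-,A_+$ are sets and $A\subseteq A_-\times A_+$. A (Tukey) morphism from $\mathbf{A}$ to $\mathbf{B}$ is a pair of functions $\phi_-\colon B_-\to A_-$, $\phi_+\colon A_+\to B_+$ such that for all $b\in B_-$ and $a\in A_+$, $\phi_-(b)\mathrel{A}a$ implies $b\mathrel{B}\phi_+(a)$. An $n$-ladder is a binary relation $\mathbf{A}$ with $|A_-|=|A_+|=n\geq1$ such that $A$ is the graph of a bijection from $A_-$ to $A_+$. A subset $Y\subseteq B_+$ is $\mathbf{B}$-dominating if for every $b\in B_-$ there is $\beta\in Y$ with $b\mathrel{B}\beta$; $\delta(\mathbf{B})$ is the minimum cardinality of a $\mathbf{B}$-dominating family ($\infty$ if none exists). The dual is $\mathbf{B}^\perp=(B_+,B_-,R)$ with $x\mathrel{R}y$ iff not $y\mathrel{B}x$. -}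

module Defs where

open import Level using (Level; _⊔_) renaming (suc to lsuc)
open import Data.Nat using (ℕ; _≤_; _<_)
open import Data.Fin using (Fin)
open import Data.Product using (Σ; ∃; _×_; _,_)
open import Relation.Nullary using (¬_)
open import Relation.Binary.PropositionalEquality using (_≡_)
open import Function.Bundles using (_⤖_; _⇔_; Bijection)

record BinRel (a b r : Level) : Set (lsuc (a ⊔ b ⊔ r)) where
  constructor binRel
  field
    Neg : Set a
    Pos : Set b
    Rel : Neg → Pos → Set r
open BinRel public

private variable a b r a' b' r' : Level

record Tukey (A : BinRel a b r) (B : BinRel a' b' r') : Set (a ⊔ b ⊔ r ⊔ a' ⊔ b' ⊔ r') where
  field
    φ₋ : Neg B → Neg A
    φ₊ : Pos A → Pos B
    preserves : ∀ (y : Neg B) (x : Pos A) → Rel A (φ₋ y) x → Rel B y (φ₊ x)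

_⊥ : BinRel a b r → BinRel b a r
(binRel N P R) ⊥ = binRel P N (λ x y → ¬ R y x)

IsDominating : (B : BinRel a b r) {k : ℕ} → (Fin k → Pos B) → Set (a ⊔ r)
IsDominating B f = ∀ (x : Neg B) → ∃ λ i → Rel B x (f i)

δ≤ : BinRel a b r → ℕ → Set (a ⊔ b ⊔ r)
δ≤ B k = Σ ℕ λ m → m ≤ k × Σ (Fin m → Pos B) (IsDominating B)

δ<∞ : BinRel a b r → Set (a ⊔ b ⊔ r)
δ<∞ B = Σ ℕ (δ≤ B)

-- 1 < δ(B) : no dominating family of cardinality ≤ 1 (δ = ∞ included).
1<δ : BinRel a b r → Set (a ⊔ b ⊔ r)
1<δ B = ¬ δ≤ B 1

IsLadder : ℕ → BinRel a b r → Set (a ⊔ b ⊔ r)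
IsLadder n A =
  (Fin n ⤖ Neg A) × (Fin n ⤖ Pos A) ×
  Σ (Neg A ⤖ Pos A) (λ g → ∀ x y → Rel A x y ⇔ (Bijection.to g x ≡ y))

-- Repeat members of a dominating family of size m (0 < m ≤ n) to get a dominating
-- family (d i) indexed by the n rungs of the ladder.  Then send b ∈ B₋ to the rung
-- whose d-value dominates it, and send the top end of rung i to d i.
module Submission where

open import Defs
open import Level using (Level)
open import Data.Nat using (ℕ; zero; suc; _≤_; z≤n; s≤s)
open import Data.Nat.Properties using (≤-trans)
open import Data.Fin using (Fin; inject≤)
open import Data.Product using (Σ; _,_; proj₁; proj₂)
open import Data.Empty using (⊥-elim)
open import Relation.Nullary using (¬_)
open import Function using (_∘_)
open import Function.Bundles using (_↔_; Bijection; Inverse; Equivalence)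
open import Function.Definitions using (StrictlySurjective)
open import Function.Properties.Bijection using (⤖⇒↔)
open import Function.Properties.Inverse using (↔-trans)
open import Relation.Binary.PropositionalEquality using (_≡_; refl; cong; subst; sym)

private variable
  a b r a' b' r' : Level
  m n : ℕ

clamp : Fin n → Fin (suc m)
clamp {m = zero}  _           = Fin.zero
clamp {m = suc m} Fin.zero    = Fin.zero
clamp {m = suc m} (Fin.suc i) = Fin.suc (clamp i)

clamp-inject≤ : (i : Fin (suc m)) (le : suc m ≤ n) → clamp (inject≤ i le) ≡ i
clamp-inject≤ {m = zero}  Fin.zero    (s≤s _)  = refl
clamp-inject≤ {m = suc m} Fin.zero    (s≤s _)  = refl
clamp-inject≤ {m = suc m} (Fin.suc i) (s≤s le) = cong Fin.suc (clamp-inject≤ i le)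

clamp-surjective : suc m ≤ n → StrictlySurjective _≡_ (clamp {n} {m})
clamp-surjective le i = inject≤ i le , clamp-inject≤ i le

module _ (B : BinRel a' b' r') where

  IsDominating-∘ : (f : Fin m → Pos B) {ρ : Fin n → Fin m} →
                   StrictlySurjective _≡_ ρ → IsDominating B f → IsDominating B (f ∘ ρ)
  IsDominating-∘ f surj dom y with dom y
  ... | i , yBfi with surj i
  ...   | j , ρj≡i = j , subst (Rel B y ∘ f) (sym ρj≡i) yBfi

  δ≤-mono : ∀ {k l} → k ≤ l → δ≤ B k → δ≤ B l
  δ≤-mono k≤l (m , m≤k , f , dom) = m , ≤-trans m≤k k≤l , f , dom

  dominatingOfSize : ¬ δ≤ B 0 → δ≤ B n → Σ (Fin n → Pos B) (IsDominating B)
  dominatingOfSize δ≢0 (zero  , _    , f , dom) = ⊥-elim (δ≢0 (zero , z≤n , f , dom))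
  dominatingOfSize δ≢0 (suc m , m≤n , f , dom) = f ∘ clamp , IsDominating-∘ f (clamp-surjective m≤n) dom

module _ (A : BinRel a b r) (B : BinRel a' b' r') where

  ladder-Tukey : IsLadder n A → (d : Fin n → Pos B) → IsDominating B d → Tukey A B
  ladder-Tukey {n} (rungs , _ , graph , A⇔graph) d dom = record
    { φ₋        = Bijection.to rungs ∘ proj₁ ∘ dom
    ; φ₊        = d ∘ Inverse.from tops
    ; preserves = preserves
    }
    where
    tops : Fin n ↔ Pos A
    tops = ↔-trans (⤖⇒↔ rungs) (⤖⇒↔ graph)

    preserves : ∀ y x → Rel A (Bijection.to rungs (proj₁ (dom y))) x → Rel B y (d (Inverse.from tops x))
    preserves y x rel = subst (Rel B y ∘ d) (sym top⁻¹x≡i) (proj₂ (dom y))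
      where
      top⁻¹x≡i : Inverse.from tops x ≡ proj₁ (dom y)
      top⁻¹x≡i = Inverse.inverseʳ tops (sym (Equivalence.to (A⇔graph _ x) rel))

lemma2p3 : ∀ {a b r a' b' r' : Level} (n : ℕ) → 1 ≤ n →
    (A : BinRel a b r) → IsLadder n A →
    (B : BinRel a' b' r') → 1<δ B → δ<∞ B → 1<δ (B ⊥) →
    δ≤ B n → Tukey A B
-- Only 1 < δ(B) (indeed only δ(B) ≠ 0) and δ(B) ≤ n are needed for the morphism to exist.
lemma2p3 n _ A ladder B 1<δB _ _ δB≤n =
  let d , dom = dominatingOfSize B (1<δB ∘ δ≤-mono B z≤n) δB≤n
  in  ladder-Tukey A B ladder d dom
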